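{- Let $\mathcal A$ be an algebra of subsets of the finite set $N$ and $P$ a probability measure on $\mathcal A$. Define $v_{\mathcal A}(S):=\sup\{P(A)\mid A\in\mathcal A,\ A\subseteq S\}$ for $S\subseteq N$. Then $v_{\mathcal A}(S)=\hat P(S)$ for all $S\subseteq N$.
   Context: An algebra $\mathcal A$ on $N$ is a family of subsets closed under union and complementation with $\emptyset,N\in\mathcal A$; a probability measure is a nonnegative additive $P:\mathcal A\to\mathbb R$ with $P(N)=1$. Let $\mathcal F=\mathcal A\setminus\{\emptyset\}$ ordered by inclusion. For $F\in\mathcal F$ let $\zeta^F:\mathcal F\to\{0,1\}$, $\zeta^F(G)=1$ iff $G\supseteq F$. The restriction of $P$ to $\mathcal F$ has a unique expansion $P=\sum_{F\in\mathcal F}\beta_F\zeta^F$ on $\mathcal F$, and its extension is $\hat P:2^N\to\mathbb R$, $\hat P(S)=\sum_{F\in\mathcal F,\,F\subseteq S}\beta_F$. -}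

module Defs where

open import Level using (Level; _⊔_; suc)
open import Data.Nat using (ℕ)
import Data.Nat as Nat
open import Data.Bool using (Bool)
import Data.Bool.Properties as BoolP
open import Data.List using (List; []; _∷_; _++_; map; foldr; filter)
open import Data.Vec using (_∷_; [])
import Data.Vec.Properties as VecP
open import Data.Fin.Subset using (Subset; _⊆_; _∪_; _∩_; ∁; ⊥; ⊤; inside; outside)
open import Data.Fin.Subset.Properties using (_⊆?_)
open import Relation.Nullary using (¬_; Dec)
open import Relation.Nullary.Decidable using (_×-dec_; ¬?)
open import Relation.Unary using (Pred; Decidable)
open import Relation.Binary.PropositionalEquality using (_≡_; _≢_)
open import Relation.Binary.Structures using (IsTotalOrder)
open import Algebra.Bundles using (CommutativeRing)

-- An ordered commutative ring (e.g. ℝ): the value domain of measures.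
-- Agda's stdlib has no reals; the statement is proved for every ordered
-- commutative ring, of which ℝ is an instance.
record OrderedCommutativeRing (c ℓ₁ ℓ₂ : Level) : Set (Level.suc (c ⊔ ℓ₁ ⊔ ℓ₂)) where
  field
    commRing : CommutativeRing c ℓ₁
  open CommutativeRing commRing public
  field
    _≤_         : Carrier → Carrier → Set ℓ₂
    isTotalOrder : IsTotalOrder _≈_ _≤_
    +-mono-≤    : ∀ {x y} z → x ≤ y → (x + z) ≤ (y + z)
    *-nonneg    : ∀ {x y} → 0# ≤ x → 0# ≤ y → 0# ≤ (x * y)

_≟ˢ_ : ∀ {n} (A B : Subset n) → Dec (A ≡ B)
_≟ˢ_ = VecP.≡-dec BoolP._≟_

allSubsets : (n : ℕ) → List (Subset n)
allSubsets Nat.zero    = [] ∷ []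
allSubsets (Nat.suc n) = map (outside ∷_) (allSubsets n) ++ map (inside ∷_) (allSubsets n)

Disjoint : ∀ {n} → Subset n → Subset n → Set
Disjoint A B = A ∩ B ≡ ⊥

record IsAlgebra {n : ℕ} (𝒜 : Pred (Subset n) Level.zero) : Set where
  field
    ∅∈   : 𝒜 ⊥
    N∈   : 𝒜 ⊤
    ∪∈   : ∀ {A B} → 𝒜 A → 𝒜 B → 𝒜 (A ∪ B)
    ∁∈   : ∀ {A} → 𝒜 A → 𝒜 (∁ A)

module _ {c ℓ₁ ℓ₂} (K : OrderedCommutativeRing c ℓ₁ ℓ₂) where
  open OrderedCommutativeRing K

  -- P : 𝒜 → K probability measure (P is given on all subsets, but only
  -- its values on members of 𝒜 are constrained or used)
  record IsProbability {n : ℕ} (𝒜 : Pred (Subset n) Level.zero) (P : Subset n → Carrier)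
         : Set (c ⊔ ℓ₁ ⊔ ℓ₂) where
    field
      nonneg   : ∀ A → 𝒜 A → 0# ≤ P A
      additive : ∀ A B → 𝒜 A → 𝒜 B → Disjoint A B → P (A ∪ B) ≈ P A + P B
      total    : P ⊤ ≈ 1#

  sumL : List Carrier → Carrier
  sumL = foldr _+_ 0#

  -- Σ_{F ∈ ℱ, F ⊆ S} β F, where ℱ = 𝒜 ∖ {∅}
  sumBelow : ∀ {n} {𝒜 : Pred (Subset n) Level.zero} → Decidable 𝒜 →
             (Subset n → Carrier) → Subset n → Carrier
  sumBelow {n} 𝒜? β S =
    sumL (map β (filter (λ F → 𝒜? F ×-dec (¬? (F ≟ˢ ⊥) ×-dec (F ⊆? S))) (allSubsets n)))

  -- β is the (Möbius) coefficient family of P|ℱ:  P(G) = Σ_{F∈ℱ, F⊆G} β_F  for G ∈ ℱ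
  IsExpansion : ∀ {n} {𝒜 : Pred (Subset n) Level.zero} → Decidable 𝒜 →
                (Subset n → Carrier) → (Subset n → Carrier) → Set (ℓ₁)
  IsExpansion {n} {𝒜} 𝒜? P β = ∀ G → 𝒜 G → G ≢ ⊥ → P G ≈ sumBelow 𝒜? β G

  extension : ∀ {n} {𝒜 : Pred (Subset n) Level.zero} → Decidable 𝒜 →
              (Subset n → Carrier) → Subset n → Carrier
  extension = sumBelow

  IsSupBelow : ∀ {n} (𝒜 : Pred (Subset n) Level.zero) → (Subset n → Carrier) →
               Subset n → Carrier → Set (c ⊔ ℓ₂)
  IsSupBelow 𝒜 P S x =
    (∀ A → 𝒜 A → A ⊆ S → P A ≤ x) ×′
    (∀ u → (∀ A → 𝒜 A → A ⊆ S → P A ≤ u) → x ≤ u)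
    where open import Data.Product using () renaming (_×_ to _×′_)

-- The 𝒜-interior S° := ⋃ {A ∈ 𝒜 | A ⊆ S} of S is the largest member of 𝒜 inside S.
-- A member F of 𝒜 lies in S iff it lies in S°, so the sums defining P̂(S) and
-- P̂(S°) agree, and P̂(S°) = P(S°) by the expansion (both vanish when S° = ∅).
-- Since P is monotone on 𝒜, P(S°) is the largest value of P on members of 𝒜 inside S.
module Submission where

open import Defs
open import Level using (Level)
open import Data.Nat using (ℕ)
open import Data.Fin.Subset using (Subset)
open import Relation.Unary using (Pred; Decidable)

open import Data.Fin.Subset using (_⊆_; _∪_; _∩_; ∁; ⊥; ⋃; inside; outside)
open import Data.Fin.Subset.Properties
  using (_⊆?_; _∈?_; ⊆-trans; ⊆-antisym; ⊥⊆; p⊆p∪q; q⊆p∪q; x∈p∪q⁺; x∈p∪q⁻; x∈p∩q⁺; x∈p∩q⁻;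
         x∉p⇒x∈∁p; x∈∁p⇒x∉p; Empty-unique; ∪-idem; ∩-idem; ∪-∩-booleanAlgebra)
import Algebra.Lattice.Properties.BooleanAlgebra as BooleanAlgebraProperties
import Algebra.Properties.Group as GroupProperties
open import Data.List using ([]; _∷_; map; filter)
open import Data.List.Properties using (filter-≐; filter-none)
open import Data.List.Membership.Propositional renaming (_∈_ to _∈ˡ_)
open import Data.List.Membership.Propositional.Properties using (∈-++⁺ˡ; ∈-++⁺ʳ; ∈-map⁺; ∈-filter⁺)
open import Data.List.Relation.Unary.Any using (here; there)
open import Data.List.Relation.Unary.All as All using (All; []; _∷_)
open import Data.List.Relation.Unary.All.Properties using (all-filter)
open import Data.Vec using ([]; _∷_)
open import Data.Product using (_,_; proj₁; proj₂)
open import Data.Sum using (inj₁; inj₂; [_,_]′)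
open import Relation.Nullary using (yes; no)
open import Relation.Nullary.Decidable using (_×-dec_)
open import Relation.Binary.PropositionalEquality as ≡ using (_≡_; refl; cong; subst)
open import Relation.Binary.Structures using (IsTotalOrder)
import Relation.Binary.Reasoning.Setoid as SetoidReasoning
open import Function using (_∘_)

∈-allSubsets : ∀ {n} (A : Subset n) → A ∈ˡ allSubsets n
∈-allSubsets {ℕ.zero} [] = here refl
∈-allSubsets {ℕ.suc n} (outside ∷ A) = ∈-++⁺ˡ (∈-map⁺ (outside ∷_) (∈-allSubsets A))
∈-allSubsets {ℕ.suc n} (inside ∷ A) =
  ∈-++⁺ʳ (map (outside ∷_) (allSubsets n)) (∈-map⁺ (inside ∷_) (∈-allSubsets A))

module _ {n : ℕ} where

  ⊆-⋃ : ∀ {A : Subset n} {As} → A ∈ˡ As → A ⊆ ⋃ As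
  ⊆-⋃ {As = B ∷ Bs} (here refl) = p⊆p∪q (⋃ Bs)
  ⊆-⋃ {As = B ∷ Bs} (there A∈As) = ⊆-trans (⊆-⋃ A∈As) (q⊆p∪q B (⋃ Bs))

  ⋃-least : ∀ {S : Subset n} {As} → All (_⊆ S) As → ⋃ As ⊆ S
  ⋃-least [] = ⊥⊆
  ⋃-least {As = A ∷ As} (A⊆S ∷ As⊆S) x∈ = [ A⊆S , ⋃-least As⊆S ]′ (x∈p∪q⁻ A (⋃ As) x∈)

  p⊆q⇒p∪[q∩∁p]≡q : ∀ {p q : Subset n} → p ⊆ q → p ∪ (q ∩ ∁ p) ≡ q
  p⊆q⇒p∪[q∩∁p]≡q {p} {q} p⊆q = ⊆-antisym ⊆q q⊆
    where
    ⊆q : p ∪ (q ∩ ∁ p) ⊆ q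
    ⊆q x∈ = [ p⊆q , (λ x∈q∩∁p → proj₁ (x∈p∩q⁻ q (∁ p) x∈q∩∁p)) ]′ (x∈p∪q⁻ p (q ∩ ∁ p) x∈)
    q⊆ : q ⊆ p ∪ (q ∩ ∁ p)
    q⊆ {x} x∈q with x ∈? p
    ... | yes x∈p = x∈p∪q⁺ (inj₁ x∈p)
    ... | no  x∉p = x∈p∪q⁺ (inj₂ (x∈p∩q⁺ (x∈q , x∉p⇒x∈∁p x∉p)))

  p∩[q∩∁p]≡⊥ : ∀ (p q : Subset n) → p ∩ (q ∩ ∁ p) ≡ ⊥
  p∩[q∩∁p]≡⊥ p q = Empty-unique λ (x , x∈) →
    let x∈p , x∈q∩∁p = x∈p∩q⁻ p (q ∩ ∁ p) x∈
    in  x∈∁p⇒x∉p (proj₂ (x∈p∩q⁻ q (∁ p) x∈q∩∁p)) x∈p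

module AlgebraProperties {n : ℕ} {𝒜 : Pred (Subset n) Level.zero} (alg : IsAlgebra 𝒜) where
  open IsAlgebra alg
  open BooleanAlgebraProperties (∪-∩-booleanAlgebra n) using (deMorgan₂; ¬-involutive)

  ∩∈ : ∀ {A B} → 𝒜 A → 𝒜 B → 𝒜 (A ∩ B)
  ∩∈ {A} {B} A∈ B∈ = subst 𝒜 ∁[∁A∪∁B]≡A∩B (∁∈ (∪∈ (∁∈ A∈) (∁∈ B∈)))
    where
    ∁[∁A∪∁B]≡A∩B : ∁ (∁ A ∪ ∁ B) ≡ A ∩ B
    ∁[∁A∪∁B]≡A∩B
      rewrite deMorgan₂ (∁ A) (∁ B) | ¬-involutive A | ¬-involutive B = refl

  ⋃∈ : ∀ {As} → All 𝒜 As → 𝒜 (⋃ As)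
  ⋃∈ [] = ∅∈
  ⋃∈ (A∈ ∷ As∈) = ∪∈ A∈ (⋃∈ As∈)

module Interior {n : ℕ} {𝒜 : Pred (Subset n) Level.zero} (𝒜? : Decidable 𝒜) (alg : IsAlgebra 𝒜)
  where
  open AlgebraProperties alg

  interior : Subset n → Subset n
  interior S = ⋃ (filter (λ A → 𝒜? A ×-dec A ⊆? S) (allSubsets n))

  interior∈ : ∀ S → 𝒜 (interior S)
  interior∈ S = ⋃∈ (All.map proj₁ (all-filter (λ A → 𝒜? A ×-dec A ⊆? S) (allSubsets n)))

  interior⊆ : ∀ S → interior S ⊆ S
  interior⊆ S = ⋃-least (All.map proj₂ (all-filter (λ A → 𝒜? A ×-dec A ⊆? S) (allSubsets n)))

  ⊆-interior : ∀ {A S} → 𝒜 A → A ⊆ S → A ⊆ interior S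
  ⊆-interior {A} {S} A∈ A⊆S =
    ⊆-⋃ (∈-filter⁺ (λ A → 𝒜? A ×-dec A ⊆? S) (∈-allSubsets A) (A∈ , A⊆S))

module _ {c ℓ₁ ℓ₂} (K : OrderedCommutativeRing c ℓ₁ ℓ₂) where
  open OrderedCommutativeRing K
  open IsTotalOrder isTotalOrder using (≤-respʳ-≈; ≤-respˡ-≈)

  x≤x+y : ∀ {x y} → 0# ≤ y → x ≤ (x + y)
  x≤x+y {x} {y} 0≤y = ≤-respˡ-≈ (+-identityˡ x) (≤-respʳ-≈ (+-comm y x) (+-mono-≤ x 0≤y))

  module _ {n : ℕ} {𝒜 : Pred (Subset n) Level.zero} (𝒜? : Decidable 𝒜)
           (β : Subset n → Carrier) where

    sumBelow-cong : ∀ {S T} → (∀ {F} → 𝒜 F → F ⊆ S → F ⊆ T) → (∀ {F} → 𝒜 F → F ⊆ T → F ⊆ S) →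
                    sumBelow K 𝒜? β S ≡ sumBelow K 𝒜? β T
    sumBelow-cong S⇒T T⇒S = cong (sumL K ∘ map β) (filter-≐ _ _
      ((λ (F∈ , F≢⊥ , F⊆S) → F∈ , F≢⊥ , S⇒T F∈ F⊆S) , (λ (F∈ , F≢⊥ , F⊆T) → F∈ , F≢⊥ , T⇒S F∈ F⊆T))
      (allSubsets n))

    sumBelow-⊥ : sumBelow K 𝒜? β ⊥ ≡ 0#
    sumBelow-⊥ = cong (sumL K ∘ map β) (filter-none _
      (All.universal (λ F (_ , F≢⊥ , F⊆⊥) → F≢⊥ (⊆-antisym F⊆⊥ ⊥⊆)) (allSubsets n)))

  module MeasureProperties {n : ℕ} {𝒜 : Pred (Subset n) Level.zero} (alg : IsAlgebra 𝒜)
                           {P : Subset n → Carrier} (prob : IsProbability K 𝒜 P) where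
    open IsAlgebra alg
    open IsProbability prob
    open AlgebraProperties alg

    P⊥≈0 : P ⊥ ≈ 0#
    P⊥≈0 = GroupProperties.identityˡ-unique +-group (P ⊥) (P ⊥)
      (sym (trans (reflexive (cong P (≡.sym (∪-idem ⊥)))) (additive ⊥ ⊥ ∅∈ ∅∈ (∩-idem ⊥))))

    P-mono : ∀ {A B} → 𝒜 A → 𝒜 B → A ⊆ B → P A ≤ P B
    P-mono {A} {B} A∈ B∈ A⊆B = ≤-respʳ-≈ (sym PB≈PA+PD) (x≤x+y (nonneg D D∈))
      where
      D : Subset n
      D = B ∩ ∁ A
      D∈ : 𝒜 D
      D∈ = ∩∈ B∈ (∁∈ A∈)
      PB≈PA+PD : P B ≈ P A + P D
      PB≈PA+PD = trans (reflexive (cong P (≡.sym (p⊆q⇒p∪[q∩∁p]≡q A⊆B))))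
                       (additive A D A∈ D∈ (p∩[q∩∁p]≡⊥ A B))

  module _ {n : ℕ} {𝒜 : Pred (Subset n) Level.zero} (𝒜? : Decidable 𝒜) (alg : IsAlgebra 𝒜)
           {P : Subset n → Carrier} (prob : IsProbability K 𝒜 P)
           {β : Subset n → Carrier} (exp : IsExpansion K 𝒜? P β) where
    open Interior 𝒜? alg
    open MeasureProperties alg prob
    open SetoidReasoning setoid

    sumBelow-interior : ∀ S → sumBelow K 𝒜? β S ≡ sumBelow K 𝒜? β (interior S)
    sumBelow-interior S = sumBelow-cong 𝒜? β ⊆-interior (λ _ F⊆S° → ⊆-trans F⊆S° (interior⊆ S))

    extension≈P∘interior : ∀ S → extension K 𝒜? β S ≈ P (interior S)
    extension≈P∘interior S with interior S ≟ˢ ⊥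
    ... | no S°≢⊥ = trans (reflexive (sumBelow-interior S)) (sym (exp (interior S) (interior∈ S) S°≢⊥))
    ... | yes S°≡⊥ = begin
      sumBelow K 𝒜? β S            ≡⟨ sumBelow-interior S ⟩
      sumBelow K 𝒜? β (interior S) ≡⟨ cong (sumBelow K 𝒜? β) S°≡⊥ ⟩
      sumBelow K 𝒜? β ⊥            ≡⟨ sumBelow-⊥ 𝒜? β ⟩
      0#                           ≈⟨ P⊥≈0 ⟨
      P ⊥                          ≡⟨ cong P S°≡⊥ ⟨
      P (interior S)               ∎

lemma5 : ∀ {c ℓ₁ ℓ₂} (K : OrderedCommutativeRing c ℓ₁ ℓ₂) (n : ℕ)
         (𝒜 : Pred (Subset n) Level.zero) (𝒜? : Decidable 𝒜) → IsAlgebra 𝒜 →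
         (P : Subset n → OrderedCommutativeRing.Carrier K) → IsProbability K 𝒜 P →
         (β : Subset n → OrderedCommutativeRing.Carrier K) → IsExpansion K 𝒜? P β →
         ∀ (S : Subset n) → IsSupBelow K 𝒜 P S (extension K 𝒜? β S)
lemma5 K n 𝒜 𝒜? alg P prob β exp S =
    (λ A A∈ A⊆S → ≤-respʳ-≈ (sym P̂S≈PS°) (P-mono A∈ (interior∈ S) (⊆-interior A∈ A⊆S)))
  , (λ u P≤u → ≤-respˡ-≈ (sym P̂S≈PS°) (P≤u (interior S) (interior∈ S) (interior⊆ S)))
  where
  open OrderedCommutativeRing K using (_≈_; sym)
  open IsTotalOrder (OrderedCommutativeRing.isTotalOrder K) using (≤-respʳ-≈; ≤-respˡ-≈)
  open Interior 𝒜? alg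
  open MeasureProperties K alg prob
  P̂S≈PS° : extension K 𝒜? β S ≈ P (interior S)
  P̂S≈PS° = extension≈P∘interior K 𝒜? alg prob exp S
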